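{- Let $A$ be a residuated lattice, $B$ a subalgebra of $A$ (as a residuated lattice), and $(L,\lambda)$ a reticulation of $A$. Then $\lambda(B)$ is a bounded distributive sublattice of $L$ and $(\lambda(B),\lambda|_B)$ is a reticulation of $B$.
   Context: A residuated lattice is an algebra $(A,\vee,\wedge,\odot,\rightarrow,0,1)$ such that $(A,\vee,\wedge,0,1)$ is a bounded lattice, $(A,\odot,1)$ is a commutative monoid, and for all $a,b,c\in A$: $a\le b\rightarrow c$ iff $a\odot b\le c$. Write $a^n=a\odot\cdots\odot a$ ($n$ factors). A reticulation of a residuated lattice $A$ is a pair $(L,\lambda)$ with $L$ a bounded distributive lattice and $\lambda:A\to L$ a function such that for all $a,b\in A$: (1) $\lambda(a\odot b)=\lambda(a)\wedge\lambda(b)$; (2) $\lambda(a\vee b)=\lambda(a)\vee\lambda(b)$; (3) $\lambda(0)=0$, $\lambda(1)=1$; (4) $\lambda$ is surjective; (5) $\lambda(a)\le\lambda(b)$ iff there is $n\ge 1$ with $a^n\le b$. -}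

module Defs where

open import Level using (Level; _⊔_; suc)
open import Data.Nat using (ℕ; zero)
import Data.Nat as ℕ
open import Data.Product using (Σ; _×_; _,_; proj₁; proj₂; ∃)
open import Relation.Binary.Core using (Rel)
open import Relation.Binary.Structures using (IsEquivalence)
open import Algebra.Core using (Op₂)
open import Algebra.Definitions using (Identity; Congruent₂)
open import Algebra.Structures using (IsCommutativeMonoid)
open import Algebra.Lattice.Structures using (IsLattice; IsDistributiveLattice)

record IsBoundedDistributiveLattice {c ℓ} {A : Set c} (_≈_ : Rel A ℓ)
         (_∨_ _∧_ : Op₂ A) (⊥ ⊤ : A) : Set (c ⊔ ℓ) where
  field
    isDistributiveLattice : IsDistributiveLattice _≈_ _∨_ _∧_
    ∨-identity            : Identity _≈_ ⊥ _∨_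
    ∧-identity            : Identity _≈_ ⊤ _∧_

record BoundedDistributiveLattice c ℓ : Set (suc (c ⊔ ℓ)) where
  infix  4 _≈_
  infixr 6 _∨_
  infixr 7 _∧_
  field
    Carrier : Set c
    _≈_     : Rel Carrier ℓ
    _∨_     : Op₂ Carrier
    _∧_     : Op₂ Carrier
    ⊥       : Carrier
    ⊤       : Carrier
    isBoundedDistributiveLattice :
      IsBoundedDistributiveLattice _≈_ _∨_ _∧_ ⊥ ⊤

  _≤_ : Rel Carrier ℓ
  x ≤ y = (x ∧ y) ≈ x

record IsResiduatedLattice {c ℓ} {A : Set c} (_≈_ : Rel A ℓ)
         (_∨_ _∧_ _⊙_ _⇒_ : Op₂ A) (𝟘 𝟙 : A) : Set (c ⊔ ℓ) where
  _≤_ : Rel A ℓ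
  x ≤ y = (x ∧ y) ≈ x
  field
    isLattice           : IsLattice _≈_ _∨_ _∧_
    ∨-identity          : Identity _≈_ 𝟘 _∨_
    ∧-identity          : Identity _≈_ 𝟙 _∧_
    ⊙-isCommutativeMonoid : IsCommutativeMonoid _≈_ _⊙_ 𝟙
    ⇒-cong              : Congruent₂ _≈_ _⇒_
    residuation⇒        : ∀ a b c → a ≤ (b ⇒ c) → (a ⊙ b) ≤ c
    residuation⇐        : ∀ a b c → (a ⊙ b) ≤ c → a ≤ (b ⇒ c)

record ResiduatedLattice c ℓ : Set (suc (c ⊔ ℓ)) where
  infix  4 _≈_
  field
    Carrier : Set c
    _≈_     : Rel Carrier ℓ
    _∨_     : Op₂ Carrier
    _∧_     : Op₂ Carrier
    _⊙_     : Op₂ Carrier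
    _⇒_     : Op₂ Carrier
    𝟘       : Carrier
    𝟙       : Carrier
    isResiduatedLattice : IsResiduatedLattice _≈_ _∨_ _∧_ _⊙_ _⇒_ 𝟘 𝟙

  open IsResiduatedLattice isResiduatedLattice public using (_≤_)

  _^_ : Carrier → ℕ → Carrier
  a ^ zero    = 𝟙
  a ^ ℕ.suc n = a ⊙ (a ^ n)

record IsReticulation {c ℓ c' ℓ'} (A : ResiduatedLattice c ℓ)
         (L : BoundedDistributiveLattice c' ℓ')
         (λ' : ResiduatedLattice.Carrier A → BoundedDistributiveLattice.Carrier L)
         : Set (c ⊔ ℓ ⊔ c' ⊔ ℓ') where
  private
    module A = ResiduatedLattice A
    module L = BoundedDistributiveLattice L
  field
    pres-⊙   : ∀ a b → λ' (a A.⊙ b) L.≈ (λ' a L.∧ λ' b)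
    pres-∨   : ∀ a b → λ' (a A.∨ b) L.≈ (λ' a L.∨ λ' b)
    pres-𝟘   : λ' A.𝟘 L.≈ L.⊥
    pres-𝟙   : λ' A.𝟙 L.≈ L.⊤
    surj     : ∀ y → Σ A.Carrier (λ a → λ' a L.≈ y)
    order⇒   : ∀ a b → λ' a L.≤ λ' b → Σ ℕ (λ n → (1 ℕ.≤ n) × ((a A.^ n) A.≤ b))
    order⇐   : ∀ a b → Σ ℕ (λ n → (1 ℕ.≤ n) × ((a A.^ n) A.≤ b)) → λ' a L.≤ λ' b

record IsSubalgebra {c ℓ p} (A : ResiduatedLattice c ℓ)
         (P : ResiduatedLattice.Carrier A → Set p) : Set (c ⊔ p) where
  open ResiduatedLattice A
  field
    ∨-closed : ∀ {a b} → P a → P b → P (a ∨ b)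
    ∧-closed : ∀ {a b} → P a → P b → P (a ∧ b)
    ⊙-closed : ∀ {a b} → P a → P b → P (a ⊙ b)
    ⇒-closed : ∀ {a b} → P a → P b → P (a ⇒ b)
    𝟘-closed : P 𝟘
    𝟙-closed : P 𝟙

subResiduatedLattice : ∀ {c ℓ p} (A : ResiduatedLattice c ℓ)
  (P : ResiduatedLattice.Carrier A → Set p) → IsSubalgebra A P →
  ResiduatedLattice (c ⊔ p) ℓ
subResiduatedLattice A P S = record
  { Carrier = Σ Carrier P
  ; _≈_ = λ x y → proj₁ x ≈ proj₁ y
  ; _∨_ = λ x y → (proj₁ x ∨ proj₁ y) , ∨-closed (proj₂ x) (proj₂ y)
  ; _∧_ = λ x y → (proj₁ x ∧ proj₁ y) , ∧-closed (proj₂ x) (proj₂ y)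
  ; _⊙_ = λ x y → (proj₁ x ⊙ proj₁ y) , ⊙-closed (proj₂ x) (proj₂ y)
  ; _⇒_ = λ x y → (proj₁ x ⇒ proj₁ y) , ⇒-closed (proj₂ x) (proj₂ y)
  ; 𝟘 = 𝟘 , 𝟘-closed
  ; 𝟙 = 𝟙 , 𝟙-closed
  ; isResiduatedLattice = record
    { isLattice = record
      { isEquivalence = record
        { refl = L.refl ; sym = L.sym ; trans = L.trans }
      ; ∨-comm = λ x y → L.∨-comm (proj₁ x) (proj₁ y)
      ; ∨-assoc = λ x y z → L.∨-assoc (proj₁ x) (proj₁ y) (proj₁ z)
      ; ∨-cong = L.∨-cong
      ; ∧-comm = λ x y → L.∧-comm (proj₁ x) (proj₁ y)
      ; ∧-assoc = λ x y z → L.∧-assoc (proj₁ x) (proj₁ y) (proj₁ z)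
      ; ∧-cong = L.∧-cong
      ; absorptive = (λ x y → proj₁ L.absorptive (proj₁ x) (proj₁ y))
                   , (λ x y → proj₂ L.absorptive (proj₁ x) (proj₁ y))
      }
    ; ∨-identity = (λ x → proj₁ R.∨-identity (proj₁ x))
                 , (λ x → proj₂ R.∨-identity (proj₁ x))
    ; ∧-identity = (λ x → proj₁ R.∧-identity (proj₁ x))
                 , (λ x → proj₂ R.∧-identity (proj₁ x))
    ; ⊙-isCommutativeMonoid = record
      { isMonoid = record
        { isSemigroup = record
          { isMagma = record
            { isEquivalence = record
              { refl = L.refl ; sym = L.sym ; trans = L.trans }
            ; ∙-cong = M.∙-cong }
          ; assoc = λ x y z → M.assoc (proj₁ x) (proj₁ y) (proj₁ z) }
        ; identity = (λ x → proj₁ M.identity (proj₁ x))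
                   , (λ x → proj₂ M.identity (proj₁ x)) }
      ; comm = λ x y → M.comm (proj₁ x) (proj₁ y) }
    ; ⇒-cong = R.⇒-cong
    ; residuation⇒ = λ a b c → R.residuation⇒ (proj₁ a) (proj₁ b) (proj₁ c)
    ; residuation⇐ = λ a b c → R.residuation⇐ (proj₁ a) (proj₁ b) (proj₁ c)
    }
  }
  where
    open ResiduatedLattice A
    open IsSubalgebra S
    module R = IsResiduatedLattice isResiduatedLattice
    module L = IsLattice R.isLattice
    module M = IsCommutativeMonoid R.⊙-isCommutativeMonoid

record IsBoundedSublattice {c ℓ q} (L : BoundedDistributiveLattice c ℓ)
         (Q : BoundedDistributiveLattice.Carrier L → Set q) : Set (c ⊔ q) where
  open BoundedDistributiveLattice L
  field
    ∨-closed : ∀ {x y} → Q x → Q y → Q (x ∨ y)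
    ∧-closed : ∀ {x y} → Q x → Q y → Q (x ∧ y)
    ⊥-closed : Q ⊥
    ⊤-closed : Q ⊤

subBoundedDistributiveLattice : ∀ {c ℓ q} (L : BoundedDistributiveLattice c ℓ)
  (Q : BoundedDistributiveLattice.Carrier L → Set q) → IsBoundedSublattice L Q →
  BoundedDistributiveLattice (c ⊔ q) ℓ
subBoundedDistributiveLattice L Q S = record
  { Carrier = Σ Carrier Q
  ; _≈_ = λ x y → proj₁ x ≈ proj₁ y
  ; _∨_ = λ x y → (proj₁ x ∨ proj₁ y) , ∨-closed (proj₂ x) (proj₂ y)
  ; _∧_ = λ x y → (proj₁ x ∧ proj₁ y) , ∧-closed (proj₂ x) (proj₂ y)
  ; ⊥ = ⊥ , ⊥-closed
  ; ⊤ = ⊤ , ⊤-closed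
  ; isBoundedDistributiveLattice = record
    { isDistributiveLattice = record
      { isLattice = record
        { isEquivalence = record
          { refl = D.refl ; sym = D.sym ; trans = D.trans }
        ; ∨-comm = λ x y → D.∨-comm (proj₁ x) (proj₁ y)
        ; ∨-assoc = λ x y z → D.∨-assoc (proj₁ x) (proj₁ y) (proj₁ z)
        ; ∨-cong = D.∨-cong
        ; ∧-comm = λ x y → D.∧-comm (proj₁ x) (proj₁ y)
        ; ∧-assoc = λ x y z → D.∧-assoc (proj₁ x) (proj₁ y) (proj₁ z)
        ; ∧-cong = D.∧-cong
        ; absorptive = (λ x y → proj₁ D.absorptive (proj₁ x) (proj₁ y))
                     , (λ x y → proj₂ D.absorptive (proj₁ x) (proj₁ y))
        }
      ; ∨-distrib-∧ = (λ x y z → proj₁ D.∨-distrib-∧ (proj₁ x) (proj₁ y) (proj₁ z))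
                    , (λ x y z → proj₂ D.∨-distrib-∧ (proj₁ x) (proj₁ y) (proj₁ z))
      ; ∧-distrib-∨ = (λ x y z → proj₁ D.∧-distrib-∨ (proj₁ x) (proj₁ y) (proj₁ z))
                    , (λ x y z → proj₂ D.∧-distrib-∨ (proj₁ x) (proj₁ y) (proj₁ z))
      }
    ; ∨-identity = (λ x → proj₁ B.∨-identity (proj₁ x))
                 , (λ x → proj₂ B.∨-identity (proj₁ x))
    ; ∧-identity = (λ x → proj₁ B.∧-identity (proj₁ x))
                 , (λ x → proj₂ B.∧-identity (proj₁ x))
    }
  }
  where
    open BoundedDistributiveLattice L
    open IsBoundedSublattice S
    module B = IsBoundedDistributiveLattice isBoundedDistributiveLattice
    module D = IsDistributiveLattice B.isDistributiveLattice

image : ∀ {c ℓ p c' ℓ'} (A : ResiduatedLattice c ℓ) (L : BoundedDistributiveLattice c' ℓ')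
  (λ' : ResiduatedLattice.Carrier A → BoundedDistributiveLattice.Carrier L)
  (P : ResiduatedLattice.Carrier A → Set p) →
  BoundedDistributiveLattice.Carrier L → Set (c ⊔ p ⊔ ℓ')
image A L λ' P y =
  Σ (ResiduatedLattice.Carrier A) (λ b → P b × BoundedDistributiveLattice._≈_ L (λ' b) y)

restrict : ∀ {c ℓ p c' ℓ'} (A : ResiduatedLattice c ℓ) (L : BoundedDistributiveLattice c' ℓ')
  (λ' : ResiduatedLattice.Carrier A → BoundedDistributiveLattice.Carrier L)
  (P : ResiduatedLattice.Carrier A → Set p) →
  Σ (ResiduatedLattice.Carrier A) P → Σ (BoundedDistributiveLattice.Carrier L) (image A L λ' P)
restrict A L λ' P (b , pb) = λ' b , (b , pb , D.refl)
  where
    module D = IsDistributiveLattice (IsBoundedDistributiveLattice.isDistributiveLattice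
                 (BoundedDistributiveLattice.isBoundedDistributiveLattice L))

-- λ(B) is closed under the lattice operations of L because λ turns ⊙ into ∧ and preserves
-- ∨, 0 and 1, and B is closed under ⊙, ∨, 0 and 1. The restriction λ|_B then inherits every
-- reticulation axiom from λ: surjectivity onto λ(B) holds by construction, and the order
-- axiom transfers because powers and the order of B are computed in A.
module Submission where

open import Defs
open import Data.Product using (Σ; _,_; proj₁)
open import Data.Nat using (ℕ; zero; suc)
open import Relation.Binary.PropositionalEquality using (_≡_; refl; cong; subst; sym)
open import Algebra.Lattice.Structures using (IsDistributiveLattice)

module Subalgebra {c ℓ p} (A : ResiduatedLattice c ℓ)
    (P : ResiduatedLattice.Carrier A → Set p) (sub : IsSubalgebra A P) where

  private
    module A = ResiduatedLattice A
    module B = ResiduatedLattice (subResiduatedLattice A P sub)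

  proj₁-^ : ∀ (a : B.Carrier) n → proj₁ (a B.^ n) ≡ proj₁ a A.^ n
  proj₁-^ a zero    = refl
  proj₁-^ a (suc n) = cong (proj₁ a A.⊙_) (proj₁-^ a n)

  ^-≤-fromSuper : ∀ (a b : B.Carrier) n → (proj₁ a A.^ n) A.≤ proj₁ b → (a B.^ n) B.≤ b
  ^-≤-fromSuper a b n = subst (λ z → z A.∧ proj₁ b A.≈ z) (sym (proj₁-^ a n))

  ^-≤-toSuper : ∀ (a b : B.Carrier) n → (a B.^ n) B.≤ b → (proj₁ a A.^ n) A.≤ proj₁ b
  ^-≤-toSuper a b n = subst (λ z → z A.∧ proj₁ b A.≈ z) (proj₁-^ a n)

module _ {c ℓ p c' ℓ'} {A : ResiduatedLattice c ℓ}
    {P : ResiduatedLattice.Carrier A → Set p} (sub : IsSubalgebra A P)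
    {L : BoundedDistributiveLattice c' ℓ'}
    {λ' : ResiduatedLattice.Carrier A → BoundedDistributiveLattice.Carrier L}
    (ret : IsReticulation A L λ') where

  private
    module A = ResiduatedLattice A
    module L = BoundedDistributiveLattice L
    module S = IsSubalgebra sub
    module R = IsReticulation ret
    module D = IsDistributiveLattice
      (IsBoundedDistributiveLattice.isDistributiveLattice L.isBoundedDistributiveLattice)
    open Subalgebra A P sub

  image-isBoundedSublattice : IsBoundedSublattice L (image A L λ' P)
  image-isBoundedSublattice = record
    { ∨-closed = λ { (a , pa , λa≈x) (b , pb , λb≈y) →
        a A.∨ b , S.∨-closed pa pb , D.trans (R.pres-∨ a b) (D.∨-cong λa≈x λb≈y) }
    ; ∧-closed = λ { (a , pa , λa≈x) (b , pb , λb≈y) →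
        a A.⊙ b , S.⊙-closed pa pb , D.trans (R.pres-⊙ a b) (D.∧-cong λa≈x λb≈y) }
    ; ⊥-closed = A.𝟘 , S.𝟘-closed , R.pres-𝟘
    ; ⊤-closed = A.𝟙 , S.𝟙-closed , R.pres-𝟙
    }

  restrict-isReticulation : IsReticulation (subResiduatedLattice A P sub)
    (subBoundedDistributiveLattice L (image A L λ' P) image-isBoundedSublattice)
    (restrict A L λ' P)
  restrict-isReticulation = record
    { pres-⊙ = λ a b → R.pres-⊙ (proj₁ a) (proj₁ b)
    ; pres-∨ = λ a b → R.pres-∨ (proj₁ a) (proj₁ b)
    ; pres-𝟘 = R.pres-𝟘
    ; pres-𝟙 = R.pres-𝟙
    ; surj   = λ { (y , b , pb , λb≈y) → (b , pb) , λb≈y }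
    ; order⇒ = λ a b λa≤λb →
        let (n , 1≤n , aⁿ≤b) = R.order⇒ (proj₁ a) (proj₁ b) λa≤λb
        in n , 1≤n , ^-≤-fromSuper a b n aⁿ≤b
    ; order⇐ = λ { a b (n , 1≤n , aⁿ≤b) →
        R.order⇐ (proj₁ a) (proj₁ b) (n , 1≤n , ^-≤-toSuper a b n aⁿ≤b) }
    }

mainTheorem3 : ∀ {c ℓ p c' ℓ'} (A : ResiduatedLattice c ℓ)
    (P : ResiduatedLattice.Carrier A → Set p) (sub : IsSubalgebra A P)
    (L : BoundedDistributiveLattice c' ℓ')
    (λ' : ResiduatedLattice.Carrier A → BoundedDistributiveLattice.Carrier L) →
    IsReticulation A L λ' →
    Σ (IsBoundedSublattice L (image A L λ' P)) (λ subL →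
      IsReticulation (subResiduatedLattice A P sub)
        (subBoundedDistributiveLattice L (image A L λ' P) subL)
        (restrict A L λ' P))
mainTheorem3 A P sub L λ' ret =
  image-isBoundedSublattice sub ret , restrict-isReticulation sub ret
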